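{- Let $d\ge2$ be an integer. For every integer $n\ge1$, $$\nu_d(\{n\}_{d,-1})=\begin{cases}\nu_d(dn/2) & \text{if $n$ is even},\\ 0 & \text{if $n$ is odd}.\end{cases}$$
   Context: $\{n\}_{d,-1}$ is defined by $\{0\}=0$, $\{1\}=1$, $\{n\}=d\{n-1\}-\{n-2\}$ for $n\ge2$. For an integer $d\ge2$, $\nu_d(m)$ denotes the largest integer $e$ such that $d^e$ divides the nonzero integer $m$, and $\nu_d(0)=\infty$. -}

module Defs where

open import Data.Nat as ℕ using (ℕ; zero; suc; _^_; _≤_)
open import Data.Integer as ℤ using (ℤ; +_; _-_; _*_)
open import Data.Integer.Divisibility using (_∣_)
open import Data.Product using (_×_)

lucas : ℕ → ℕ → ℤ
lucas d zero = + 0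
lucas d (suc zero) = + 1
lucas d (suc (suc n)) = (+ d) * lucas d (suc n) - lucas d n

-- IsNu d m e : e is the largest natural number such that d^e divides m,
-- i.e. ν_d(m) = e  (only meaningful / satisfiable for m ≠ 0)
IsNu : ℕ → ℤ → ℕ → Set
IsNu d m e = ((+ (d ^ e)) ∣ m) × (∀ f → (+ (d ^ f)) ∣ m → f ≤ e)

module Submission where

-- Write L = lucas d. The recurrence gives L (2k) ≡ 0 (mod d) and L (2k+1) ≡ (-1)^k (mod d²); with the
-- addition formula L (m+n+1) = L (m+1) L (n+1) - L m L n this yields, for even N,
-- L (t N) ≡ ±t · L N (mod L N · d²). Taking t = d repeatedly gives L (2 d^a) = d^(a+1) u with
-- u ≡ ±1 (mod d), hence L (2 d^a t) = d^(a+1) · u (±t + q d²) whose cofactor is not divisible by d when d ∤ t;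
-- so both L n and d n / 2 have valuation a + 1 when n = 2 d^a t. For odd n, L n ≡ ±1 (mod d).

module LucasValuation where

  open import Defs using (lucas; IsNu)
  open import Data.Nat as ℕ using (ℕ; zero; suc; NonZero; NonTrivial)
  import Data.Nat.Properties as ℕ
  import Data.Nat.Divisibility as ℕ
  open import Data.Nat.Induction using (<-wellFounded)
  open import Induction.WellFounded using (Acc; acc)
  open import Data.Integer using (ℤ; +_; -1ℤ; 0ℤ; 1ℤ; _+_; _-_; _*_; _^_)
  import Data.Integer.Properties as ℤ
  open import Data.Integer.Divisibility.Signed
  open import Data.Integer.Tactic.RingSolver using (solve-∀)
  import Data.Nat.Tactic.RingSolver as ℕ
  import Data.Integer.Divisibility as Unsigned
  open import Data.Product using (∃-syntax; ∃₂; _×_; _,_)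
  open import Function using (_∘_)
  open import Relation.Nullary using (¬_; yes; no; contradiction)
  open import Relation.Binary.PropositionalEquality

  ^-monoʳ-∣ : ∀ m {n o} → n ℕ.≤ o → m ℕ.^ n ℕ.∣ m ℕ.^ o
  ^-monoʳ-∣ m {n} {o} n≤o =
    subst (m ℕ.^ n ℕ.∣_) (trans (sym (ℕ.^-distribˡ-+-* m n (o ℕ.∸ n))) (cong (m ℕ.^_) (ℕ.m+[n∸m]≡n n≤o)))
          (ℕ.m∣m*n (m ℕ.^ (o ℕ.∸ n)))

  infix 4 _≡_[mod_] _≡±1[mod_]

  _≡_[mod_] : ℤ → ℤ → ℤ → Set
  x ≡ y [mod m ] = ∃[ q ] x ≡ y + q * m

  _≡±1[mod_] : ℤ → ℤ → Set
  u ≡±1[mod m ] = ∃[ e ] u ≡ -1ℤ ^ e [mod m ]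

  -1^e*-1^e≡1 : ∀ e → -1ℤ ^ e * -1ℤ ^ e ≡ 1ℤ
  -1^e*-1^e≡1 zero = refl
  -1^e*-1^e≡1 (suc e) = trans (square-neg (-1ℤ ^ e)) (-1^e*-1^e≡1 e)
    where
    square-neg : ∀ x → (-1ℤ * x) * (-1ℤ * x) ≡ x * x
    square-neg = solve-∀

  -1^e≡±1 : ∀ e {m} → -1ℤ ^ e ≡±1[mod m ]
  -1^e≡±1 e = e , 0ℤ , sym (ℤ.+-identityʳ (-1ℤ ^ e))

  ≡±1-* : ∀ {m u v} → u ≡±1[mod m ] → v ≡±1[mod m ] → u * v ≡±1[mod m ]
  ≡±1-* {m} (e , w , refl) (f , z , refl) =
    e ℕ.+ f , -1ℤ ^ e * z + w * -1ℤ ^ f + w * z * m ,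
    trans (expand (-1ℤ ^ e) (-1ℤ ^ f) w z m)
          (cong (_+ (-1ℤ ^ e * z + w * -1ℤ ^ f + w * z * m) * m) (sym (ℤ.^-distribˡ-+-* -1ℤ e f)))
    where
    expand : ∀ s t w z m → (s + w * m) * (t + z * m) ≡ s * t + (s * z + w * t + w * z * m) * m
    expand = solve-∀

  -- Multiplying by -1^e undoes the leading sign of u, leaving v plus a multiple of m.
  ≡±1-∣*⇒∣ : ∀ {m u v} → u ≡±1[mod m ] → m ∣ u * v → m ∣ v
  ≡±1-∣*⇒∣ {m} {v = v} (e , w , refl) m∣uv =
    ∣m+n∣n⇒∣m (subst (m ∣_) unwind (∣n⇒∣m*n (-1ℤ ^ e) m∣uv)) (∣m⇒∣m*n (-1ℤ ^ e * w * v) ∣-refl)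
    where
    s : ℤ
    s = -1ℤ ^ e
    expand : ∀ s w m v → s * ((s + w * m) * v) ≡ s * s * v + m * (s * w * v)
    expand = solve-∀
    unwind : s * ((s + w * m) * v) ≡ v + m * (s * w * v)
    unwind = begin
      s * ((s + w * m) * v)       ≡⟨ expand s w m v ⟩
      s * s * v + m * (s * w * v) ≡⟨ cong (λ x → x * v + m * (s * w * v)) (-1^e*-1^e≡1 e) ⟩
      1ℤ * v + m * (s * w * v)    ≡⟨ cong (_+ m * (s * w * v)) (ℤ.*-identityˡ v) ⟩
      v + m * (s * w * v)         ∎
      where open ≡-Reasoning

  module _ (d : ℕ) where

    private
      L : ℕ → ℤ
      L = lucas d
      D : ℤ
      D = + d

    lucas-+ : ∀ m n → L (n ℕ.+ suc m) ≡ L (suc m) * L (suc n) - L m * L n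
    lucas-+ m zero = base (L (suc m)) (L m)
      where
      base : ∀ x y → x ≡ x * 1ℤ - y * 0ℤ
      base = solve-∀
    lucas-+ m (suc zero) = base (L (suc m)) (L m) D
      where
      base : ∀ x y D → D * x - y ≡ x * (D * 1ℤ - 0ℤ) - y * 1ℤ
      base = solve-∀
    lucas-+ m (suc (suc n)) =
      trans (cong₂ (λ u v → D * u - v) (lucas-+ m (suc n)) (lucas-+ m n))
            (step D (L (suc m)) (L m) (L (suc (suc n))) (L (suc n)) (L n))
      where
      step : ∀ D a b x y z → D * (a * x - b * y) - (a * y - b * z) ≡ a * (D * x - y) - b * (D * y - z)
      step = solve-∀

    lucas-parity : ∀ k → L (k ℕ.* 2) ≡ 0ℤ [mod D ] × L (suc (k ℕ.* 2)) ≡ -1ℤ ^ k [mod D * D ]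
    lucas-parity zero = (0ℤ , refl) , (0ℤ , refl)
    lucas-parity (suc k) with lucas-parity k
    ... | (a , even≡) , (b , odd≡) =
      (y - a , trans (cong (λ z → D * y - z) even≡) (even-step D y a)) ,
      (-1ℤ ^ k + b * (D * D) - a - b , trans (cong₂ (λ y z → D * (D * y - z) - y) odd≡ even≡) (odd-step D (-1ℤ ^ k) a b))
      where
      y = L (suc (k ℕ.* 2))
      even-step : ∀ D y a → D * y - (0ℤ + a * D) ≡ 0ℤ + (y - a) * D
      even-step = solve-∀
      odd-step : ∀ D s a b → D * (D * (s + b * (D * D)) - (0ℤ + a * D)) - (s + b * (D * D))
                             ≡ -1ℤ * s + (s + b * (D * D) - a - b) * (D * D)
      odd-step = solve-∀

    lucas-multiple : ∀ M t .{{_ : NonZero M}} .{{_ : NonZero t}} →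
      L (t ℕ.* (M ℕ.* 2)) ≡ -1ℤ ^ (ℕ.pred t ℕ.* M) * + t * L (M ℕ.* 2) [mod L (M ℕ.* 2) * (D * D) ]
    lucas-multiple (suc K) 1 = 0ℤ , trans (cong L (ℕ.+-identityʳ (suc K ℕ.* 2))) (base (L (suc K ℕ.* 2)) D)
      where
      base : ∀ X D → X ≡ 1ℤ * 1ℤ * X + 0ℤ * (X * (D * D))
      base = solve-∀
    lucas-multiple (suc K) (suc (suc t))
      with lucas-multiple (suc K) (suc t) | lucas-parity (suc K) | lucas-parity (K ℕ.+ t ℕ.* suc K)
    ... | q , current≡ | _ , (b , next≡) | _ , (c , previous≡) = Q , (begin
        L (N ℕ.+ suc m)
      ≡⟨ lucas-+ m N ⟩
        L (suc m) * L (suc N) - L m * X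
      ≡⟨ cong₂ (λ u v → u * L (suc N) - v * X) current≡ (trans (cong (λ i → L (suc i)) m-half) previous≡) ⟩
        (s * T * X + q * (X * (D * D))) * L (suc N) - (P + c * (D * D)) * X
      ≡⟨ cong₂ (λ u v → (s * T * X + q * (X * (D * D))) * u - (v + c * (D * D)) * X) next≡ P≡ ⟩
        (s * T * X + q * (X * (D * D))) * (r + b * (D * D)) - (-1ℤ * (r * s) + c * (D * D)) * X
      ≡⟨ expand r s T X q b c D ⟩
        -1ℤ * (-1ℤ * (r * s)) * (1ℤ + T) * X + Q * (X * (D * D))
      ≡⟨ cong (λ v → -1ℤ * v * (1ℤ + T) * X + Q * (X * (D * D))) (sym P≡) ⟩
        -1ℤ * P * (1ℤ + T) * X + Q * (X * (D * D))
      ∎)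
      where
      open ≡-Reasoning
      N m p : ℕ
      N = suc K ℕ.* 2
      -- N ℕ.+ suc m reduces to suc (suc t) ℕ.* N, and m = p * 2 + 1 is odd.
      m = suc (K ℕ.* 2 ℕ.+ t ℕ.* N)
      p = K ℕ.+ t ℕ.* suc K
      X T r s P Q : ℤ
      X = L N
      T = + suc t
      r = -1ℤ ^ suc K
      s = -1ℤ ^ (t ℕ.* suc K)
      P = -1ℤ ^ p
      Q = s * T * b + q * r + q * b * (D * D) - c
      m-half : K ℕ.* 2 ℕ.+ t ℕ.* N ≡ p ℕ.* 2
      m-half = regroup K t
        where
        regroup : ∀ K t → K ℕ.* 2 ℕ.+ t ℕ.* (suc K ℕ.* 2) ≡ (K ℕ.+ t ℕ.* suc K) ℕ.* 2
        regroup = ℕ.solve-∀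
      P≡ : P ≡ -1ℤ * (r * s)
      P≡ = begin
        P                       ≡⟨ sym (square-neg P) ⟩
        -1ℤ * (-1ℤ ^ suc p)     ≡⟨ cong (-1ℤ *_) (ℤ.^-distribˡ-+-* -1ℤ (suc K) (t ℕ.* suc K)) ⟩
        -1ℤ * (r * s)           ∎
        where
        square-neg : ∀ x → -1ℤ * (-1ℤ * x) ≡ x
        square-neg = solve-∀
      expand : ∀ r s T X q b c D →
        (s * T * X + q * (X * (D * D))) * (r + b * (D * D)) - (-1ℤ * (r * s) + c * (D * D)) * X
        ≡ -1ℤ * (-1ℤ * (r * s)) * (1ℤ + T) * X + (s * T * b + q * r + q * b * (D * D) - c) * (X * (D * D))
      expand = solve-∀

    lucas-d^a*2 : .{{_ : NonZero d}} → ∀ a →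
      ∃[ u ] u ≡±1[mod D ] × L (d ℕ.^ a ℕ.* 2) ≡ + (d ℕ.^ suc a) * u
    lucas-d^a*2 zero =
      1ℤ , -1^e≡±1 0 , trans (base D) (cong (λ z → + z * 1ℤ) (sym (ℕ.*-identityʳ d)))
      where
      base : ∀ D → D * 1ℤ - 0ℤ ≡ D * 1ℤ
      base = solve-∀
    lucas-d^a*2 (suc a)
      with lucas-d^a*2 a | lucas-multiple (d ℕ.^ a) d {{ℕ.m^n≢0 d a}}
    ... | u , u≡±1 , X≡ | q , multiple≡ = u * (s + q * D) , ≡±1-* u≡±1 (e , q , refl) , (begin
        L (d ℕ.^ suc a ℕ.* 2)                          ≡⟨ cong L (ℕ.*-assoc d (d ℕ.^ a) 2) ⟩
        L (d ℕ.* (d ℕ.^ a ℕ.* 2))                      ≡⟨ multiple≡ ⟩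
        s * D * X + q * (X * (D * D))                  ≡⟨ cong (λ X → s * D * X + q * (X * (D * D))) X≡ ⟩
        s * D * (P * u) + q * (P * u * (D * D))        ≡⟨ regroup s D P u q ⟩
        D * P * (u * (s + q * D))                      ≡⟨ cong (_* (u * (s + q * D))) (ℤ.pos-* d (d ℕ.^ suc a)) ⟨
        + (d ℕ.^ suc (suc a)) * (u * (s + q * D))      ∎)
      where
      open ≡-Reasoning
      e : ℕ
      e = ℕ.pred d ℕ.* d ℕ.^ a
      s X P : ℤ
      s = -1ℤ ^ e
      X = L (d ℕ.^ a ℕ.* 2)
      P = + (d ℕ.^ suc a)
      regroup : ∀ s D P u q → s * D * (P * u) + q * (P * u * (D * D)) ≡ D * P * (u * (s + q * D))
      regroup = solve-∀

    IsNu-intro : .{{_ : NonZero d}} → ∀ e {x y} → x ≡ + (d ℕ.^ e) * y → ¬ (D ∣ y) → IsNu d x e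
    IsNu-intro e {x} {y} x≡ D∤y = ∣⇒∣ᵤ (divides y x≡y*d^e) , maximal
      where
      x≡y*d^e : x ≡ y * + (d ℕ.^ e)
      x≡y*d^e = trans x≡ (ℤ.*-comm (+ (d ℕ.^ e)) y)
      maximal : ∀ f → + (d ℕ.^ f) Unsigned.∣ x → f ℕ.≤ e
      maximal f d^f∣x with f ℕ.≤? e
      ... | yes f≤e = f≤e
      ... | no f≰e = contradiction (*-cancelʳ-∣ (+ (d ℕ.^ e)) {{ℕ.m^n≢0 d e}} d*d^e∣y*d^e) D∤y
        where
        d^[1+e]∣x : + (d ℕ.^ suc e) ∣ x
        d^[1+e]∣x = ∣ᵤ⇒∣ (ℕ.∣-trans (^-monoʳ-∣ d (ℕ.≰⇒> f≰e)) d^f∣x)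
        d*d^e∣y*d^e : D * + (d ℕ.^ e) ∣ y * + (d ℕ.^ e)
        d*d^e∣y*d^e = subst₂ _∣_ (ℤ.pos-* d (d ℕ.^ e)) x≡y*d^e d^[1+e]∣x

    lucas-t*d^a*2 : .{{_ : NonZero d}} → ∀ a t .{{_ : NonZero t}} →
      ∃[ v ] L (t ℕ.* (d ℕ.^ a ℕ.* 2)) ≡ + (d ℕ.^ suc a) * v × (D ∣ v → d ℕ.∣ t)
    lucas-t*d^a*2 a t with lucas-d^a*2 a | lucas-multiple (d ℕ.^ a) t {{ℕ.m^n≢0 d a}}
    ... | u , u≡±1 , X≡ | q , multiple≡ = u * (s * + t + q * (D * D)) , (begin
        L (t ℕ.* (d ℕ.^ a ℕ.* 2))                     ≡⟨ multiple≡ ⟩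
        s * + t * X + q * (X * (D * D))               ≡⟨ cong (λ X → s * + t * X + q * (X * (D * D))) X≡ ⟩
        s * + t * (P * u) + q * (P * u * (D * D))     ≡⟨ regroup s (+ t) P u q D ⟩
        P * (u * (s * + t + q * (D * D)))             ∎) , D∣v⇒d∣t
      where
      open ≡-Reasoning
      s X P : ℤ
      s = -1ℤ ^ (ℕ.pred t ℕ.* d ℕ.^ a)
      X = L (d ℕ.^ a ℕ.* 2)
      P = + (d ℕ.^ suc a)
      regroup : ∀ s T P u q D → s * T * (P * u) + q * (P * u * (D * D)) ≡ P * (u * (s * T + q * (D * D)))
      regroup = solve-∀
      D∣v⇒d∣t : D ∣ u * (s * + t + q * (D * D)) → d ℕ.∣ t
      D∣v⇒d∣t D∣v = ∣⇒∣ᵤ (≡±1-∣*⇒∣ {v = + t} (-1^e≡±1 (ℕ.pred t ℕ.* d ℕ.^ a)) D∣s*t)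
        where
        D∣s*t : D ∣ s * + t
        D∣s*t = ∣m+n∣n⇒∣m (≡±1-∣*⇒∣ u≡±1 D∣v) (∣n⇒∣m*n q (∣m⇒∣m*n D ∣-refl))

    module _ .{{_ : NonTrivial d}} where

      private instance
        d≢0 : NonZero d
        d≢0 = ℕ.nonTrivial⇒nonZero d

      ≡±1⇒∤ : ∀ {u} → u ≡±1[mod D ] → ¬ (D ∣ u)
      ≡±1⇒∤ u≡±1 D∣u =
        ℕ.nonTrivial⇒≢1 (ℕ.∣1⇒≡1 (∣⇒∣ᵤ (≡±1-∣*⇒∣ u≡±1 (subst (D ∣_) (sym (ℤ.*-identityʳ _)) D∣u))))

      power-decomposition : ∀ m .{{_ : NonZero m}} → ∃₂ λ a t → m ≡ d ℕ.^ a ℕ.* t × ¬ (d ℕ.∣ t)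
      power-decomposition m = go m (<-wellFounded m)
        where
        go : ∀ m .{{_ : NonZero m}} → Acc ℕ._<_ m → ∃₂ λ a t → m ≡ d ℕ.^ a ℕ.* t × ¬ (d ℕ.∣ t)
        go m (acc smaller) with d ℕ.∣? m
        ... | no d∤m = 0 , m , sym (ℕ.+-identityʳ m) , d∤m
        ... | yes d∣m with go (ℕ.quotient d∣m) {{ℕ.quotient≢0 d∣m}} (smaller (ℕ.quotient-< d∣m))
        ...   | a , t , q≡ , d∤t =
          suc a , t , trans (ℕ.m∣n⇒n≡m*quotient d∣m) (trans (cong (d ℕ.*_) q≡) (sym (ℕ.*-assoc d (d ℕ.^ a) t))) , d∤t

      lucas-even-valuation : ∀ m .{{_ : NonZero m}} → ∃[ e ] IsNu d (L (m ℕ.* 2)) e × IsNu d (+ (d ℕ.* m)) e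
      lucas-even-valuation m with power-decomposition m
      ... | a , t , refl , d∤t with lucas-t*d^a*2 a t {{ℕ.≢-nonZero λ { refl → d∤t (d ℕ.∣0) }}}
      ...   | v , L≡ , D∣v⇒d∣t =
        suc a , IsNu-intro (suc a) (trans (cong L (reorder (d ℕ.^ a) t)) L≡) (d∤t ∘ D∣v⇒d∣t) ,
                IsNu-intro (suc a) (trans (cong +_ (sym (ℕ.*-assoc d (d ℕ.^ a) t))) (ℤ.pos-* (d ℕ.^ suc a) t))
                           (d∤t ∘ ∣⇒∣ᵤ)
        where
        reorder : ∀ x t → x ℕ.* t ℕ.* 2 ≡ t ℕ.* (x ℕ.* 2)
        reorder = ℕ.solve-∀

      lucas-odd-valuation : ∀ k → IsNu d (L (suc (k ℕ.* 2))) 0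
      lucas-odd-valuation k with lucas-parity k
      ... | _ , (b , odd≡) = IsNu-intro 0 (sym (ℤ.*-identityˡ _)) (≡±1⇒∤ (k , b * D , odd≡′))
        where
        odd≡′ : L (suc (k ℕ.* 2)) ≡ -1ℤ ^ k + b * D * D
        odd≡′ = trans odd≡ (cong (λ z → -1ℤ ^ k + z) (sym (ℤ.*-assoc b D D)))

open LucasValuation using (lucas-even-valuation; lucas-odd-valuation)

open import Defs
open import Data.Nat using (ℕ; _≤_; _+_; _*_; _/_; _%_; NonZero; NonTrivial; ≢-nonZero; n>1⇒nonTrivial)
open import Data.Nat.Properties using (<⇒≢)
open import Data.Nat.DivMod using (m≡m%n+[m/n]*n; m/n*n≡m; *-/-assoc)
open import Data.Nat.Divisibility using (_∣_; m%n≡0⇒n∣m)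
open import Data.Integer using (+_)
open import Data.Product using (_×_; _,_; ∃-syntax)
open import Relation.Binary.PropositionalEquality using (_≡_; sym; trans; cong; subst; subst₂)

proposition3p6 : (d : ℕ) → 2 ≤ d → (n : ℕ) → 1 ≤ n →
    ((n % 2 ≡ 0) → ∃[ e ] (IsNu d (lucas d n) e × IsNu d (+ ((d * n) / 2)) e))
    × ((n % 2 ≡ 1) → IsNu d (lucas d n) 0)
proposition3p6 d 2≤d n 1≤n = even , odd
  where
  instance
    d-nonTrivial : NonTrivial d
    d-nonTrivial = n>1⇒nonTrivial 2≤d

  even : n % 2 ≡ 0 → ∃[ e ] (IsNu d (lucas d n) e × IsNu d (+ ((d * n) / 2)) e)
  even n%2≡0 = subst₂ (λ i j → ∃[ e ] (IsNu d (lucas d i) e × IsNu d (+ j) e)) n/2*2≡n (sym (*-/-assoc d 2∣n))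
                      (lucas-even-valuation d (n / 2) {{n/2≢0}})
    where
    2∣n : 2 ∣ n
    2∣n = m%n≡0⇒n∣m n 2 n%2≡0
    n/2*2≡n : n / 2 * 2 ≡ n
    n/2*2≡n = m/n*n≡m 2∣n
    n/2≢0 : NonZero (n / 2)
    n/2≢0 = ≢-nonZero λ n/2≡0 → <⇒≢ 1≤n (trans (sym (cong (_* 2) n/2≡0)) n/2*2≡n)

  odd : n % 2 ≡ 1 → IsNu d (lucas d n) 0
  odd n%2≡1 = subst (λ i → IsNu d (lucas d i) 0) (sym n≡) (lucas-odd-valuation d (n / 2))
    where
    n≡ : n ≡ 1 + n / 2 * 2
    n≡ = trans (m≡m%n+[m/n]*n n 2) (cong (_+ n / 2 * 2) n%2≡1)
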